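{- Let $G$ be a finite connected even graph, let $\mathcal{C}$ be a cycle decomposition of $G$, and let $CI(G)$ be the cycle intersection graph of $G$ with respect to $\mathcal{C}$. If $CI(G)$ is a tree, then $\nabla(G)=|MSF(CI(G))|$.
   Context: An even graph is a graph in which every vertex has even degree (multiple edges are allowed). A cycle decomposition of $G$ is a collection of cycles of $G$ whose edge sets partition $E(G)$. The cycle intersection graph $CI(G)$ with respect to $\mathcal{C}$ is the (multi)graph with vertex set $\mathcal{C}$ having, for each pair of distinct cycles $C,C'\in\mathcal{C}$ and each vertex $v\in V(C)\cap V(C')$, one edge joining $C$ and $C'$. For a graph $H$, the size of a spanning forest $F$ of $H$ (a spanning acyclic subgraph) is $|E(F)|$ plus the number of vertices of degree $0$ in $F$; $|MSF(H)|$ denotes the minimum size of a spanning forest of $H$. A decycling set of $G$ is a set $S\subseteq V(G)$ with $G\setminus S$ acyclic; $\nabla(G)$ is the minimum size of a decycling set. -}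

module Defs where

open import Data.Nat using (ℕ; zero; suc; _+_; _≤_; _<_; _%_)
open import Data.Nat.DivMod using (m%n<n)
open import Data.Nat.ListAction using (sum)
open import Data.Nat.Divisibility using (_∣_)
open import Data.Fin using (Fin; toℕ; fromℕ<)
open import Data.Fin.Properties using (any?; _≟_)
open import Data.Fin.Subset using (Subset; _∈_; _∉_; ∣_∣)
open import Data.List using (List; []; _∷_; length; lookup; concatMap; allFin; map)
open import Data.Product using (Σ; ∃; _×_; _,_; proj₁; proj₂)
open import Data.Sum using (_⊎_)
open import Data.Bool using (Bool; true; false; if_then_else_)
open import Relation.Nullary using (¬_; Dec; yes; no)
open import Relation.Nullary.Decidable using (⌊_⌋; _×-dec_)
open import Relation.Binary.PropositionalEquality using (_≡_; _≢_)
open import Function.Definitions using (Injective)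
import Data.Vec

-- A finite multigraph on vertex set Fin n is given by its list of edges;
-- edges are identified by their position in the list (so parallel edges
-- are distinct edges).
Graph : ℕ → Set
Graph n = List (Fin n × Fin n)

module _ {n : ℕ} (G : Graph n) where

  Edge : Set
  Edge = Fin (length G)

  ends : Edge → Fin n × Fin n
  ends e = lookup G e

  Joins : Edge → Fin n → Fin n → Set
  Joins e a b = ends e ≡ (a , b) ⊎ ends e ≡ (b , a)

  Loopless : Set
  Loopless = ∀ e → proj₁ (ends e) ≢ proj₂ (ends e)

  -- degree (a loop would count twice)
  degree : Fin n → ℕ
  degree v = sum (map (λ p → ind (proj₁ p) + ind (proj₂ p)) G)
    where
      ind : Fin n → ℕ
      ind w = if ⌊ w ≟ v ⌋ then 1 else 0

  Even : Set
  Even = ∀ v → 2 ∣ degree v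

  data Reachable : Fin n → Fin n → Set where
    here : ∀ {u} → Reachable u u
    step : ∀ {u w v} (e : Edge) → Joins e u w → Reachable w v → Reachable u v

  Connected : Set
  Connected = ∀ u v → Reachable u v

  next : {k : ℕ} → Fin (suc k) → Fin (suc k)
  next {k} i = fromℕ< (m%n<n (suc (toℕ i)) (suc k))

  record Cycle : Set where
    field
      len₋₁ : ℕ
      vert  : Fin (suc len₋₁) → Fin n
      edge  : Fin (suc len₋₁) → Edge
      vert-inj : Injective _≡_ _≡_ vert
      edge-inj : Injective _≡_ _≡_ edge
      joins : ∀ i → Joins (edge i) (vert i) (vert (next i))

  open Cycle public

  OnCycle : Fin n → Cycle → Set
  OnCycle v C = ∃ λ i → vert C i ≡ v

  onCycle? : ∀ v C → Dec (OnCycle v C)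
  onCycle? v C = any? (λ i → vert C i ≟ v)

  Acyclic : Set
  Acyclic = ¬ Cycle

  IsTree : Set
  IsTree = Connected × Acyclic

  record CycleDecomp : Set where
    field
      count : ℕ
      cyc   : Fin count → Cycle
      cover : ∀ e → ∃ λ j → ∃ λ i → edge (cyc j) i ≡ e
      disjoint : ∀ e j j' i i' → edge (cyc j) i ≡ e → edge (cyc j') i' ≡ e → j ≡ j'

  open CycleDecomp public

  -- Cycle intersection graph: vertices are the cycles; for each pair j < j'
  -- and each common vertex v one edge joining j and j'.
  CI : (D : CycleDecomp) → Graph (count D)
  CI D =
    concatMap (λ j →
    concatMap (λ j' →
    concatMap (λ v →
      if ⌊ (toℕ j Data.Nat.<? toℕ j') ×-dec (onCycle? v (cyc D j) ×-dec onCycle? v (cyc D j')) ⌋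
      then (j , j') ∷ [] else [])
      (allFin n)) (allFin (count D))) (allFin (count D))

  -- Deleting a vertex set S leaves an acyclic graph iff no cycle of G
  -- avoids S.
  Decycling : Subset n → Set
  Decycling S = ¬ (Σ Cycle λ C → ∀ i → vert C i ∉ S)

  DecyclingNumber : ℕ → Set
  DecyclingNumber k =
    (∃ λ S → Decycling S × ∣ S ∣ ≡ k) × (∀ S → Decycling S → k ≤ ∣ S ∣)

keep : ∀ {A : Set} (es : List A) → Subset (length es) → List A
keep [] _ = []
keep (x ∷ es) (Data.Fin.Subset.inside Data.Vec.∷ S) = x ∷ keep es S
keep (x ∷ es) (Data.Fin.Subset.outside Data.Vec.∷ S) = keep es S

module _ {n : ℕ} (H : Graph n) where

  spanSub : Subset (length H) → Graph n
  spanSub S = keep H S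

  SpanningForest : Subset (length H) → Set
  SpanningForest S = Acyclic (spanSub S)

  isolated : Graph n → ℕ
  isolated F = sum (map (λ v → if ⌊ degree F v Data.Nat.≟ 0 ⌋ then 1 else 0) (allFin n))

  forestSize : Subset (length H) → ℕ
  forestSize S = length (spanSub S) + isolated (spanSub S)

  MSFSize : ℕ → Set
  MSFSize k =
    (∃ λ S → SpanningForest S × forestSize S ≡ k)
    × (∀ S → SpanningForest S → k ≤ forestSize S)

module Submission where

-- Label each edge of CI by the vertex of G it was created for.  Walking around a cycle C of G
-- and recording which cycle of the decomposition owns each edge, every change of owner happens
-- at a vertex of C and is witnessed by a CI-edge labelled by that vertex; distinct changes give
-- distinct labels, hence a closed trail in CI, which the tree CI cannot contain.  So all edges
-- of C lie on one decomposition cycle, which (G being loopless) then lies inside C, and a vertex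
-- set is decycling iff it meets every decomposition cycle.  Since the cycles through a vertex are
-- pairwise adjacent in CI, acyclicity also makes the labelling injective.  A spanning forest F of
-- CI thus gives the decycling set of its edge labels plus one vertex of each isolated cycle, of
-- size at most |F|; conversely the CI-edges labelled in a decycling set S form a forest, and S
-- contains their labels and, for each cycle they leave isolated, a vertex lying on no other
-- cycle.

open import Defs
open import Data.Bool using (Bool; true; false; if_then_else_)
open import Data.Bool.Properties using (T-≡)
open import Data.Empty using (⊥-elim)
open import Data.Fin using (Fin; zero; suc; toℕ; cast)
open import Data.Fin.Properties using (_≟_; any?; toℕ-injective; toℕ<n; toℕ-fromℕ<; cast-involutive)
import Data.Fin.Properties as Finₚ
open import Data.Fin.Subset using (Subset; _∈_; ∣_∣; inside; outside; ⁅_⁆; _∪_; _-_; ⊥)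
open import Data.Fin.Subset.Properties
  using (_∈?_; ∣⁅x⁆∣≡1; ∣⊥∣≡0; x∈p∪q⁺; x∈⁅x⁆; x∈p⇒∣p-x∣<∣p∣; x∈p∧x≢y⇒x∈p-y)
open import Data.List using (List; []; _∷_; length; lookup; concatMap; allFin; map)
import Data.List as List
open import Data.List.Properties using (map-tabulate; length-map; map-concatMap; concatMap-cong)
open import Data.List.Membership.Propositional using () renaming (_∈_ to _∈ˡ_)
open import Data.List.Membership.Propositional.Properties using (∈-concatMap⁺; ∈-concatMap⁻; ∈-allFin; ∈-lookup)
open import Data.List.Relation.Unary.Any using (here; there; satisfied)
import Data.List.Relation.Unary.Any as Any
import Data.List.Relation.Unary.Any.Properties as Anyₚ
open import Data.Maybe using (Maybe; just; nothing)
open import Data.Nat using (ℕ; zero; suc; _+_; _∸_; _≤_; _<_; _%_; z≤n; s≤s; s≤s⁻¹; _<?_)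
import Data.Nat as ℕ
open import Data.Nat.DivMod using (_mod_; m%n%n≡m%n; %-distribˡ-+; m<n⇒m%n≡m; n%n≡0; [m+n]%n≡m%n)
open import Data.Nat.Induction using (<-rec)
open import Data.Nat.ListAction using (sum)
open import Data.Nat.Properties
  using ( module ≤-Reasoning; ≤-refl; ≤-reflexive; ≤-trans; ≤-antisym; ≤-total; <-irrefl; <-asym
        ; <-trans; <-≤-trans; ≤-<-trans; <-cmp; <⇒≤; ≤⇒≯; ≮⇒≥; n≤1+n; n<1+n; m<n⇒m<1+n; n≮0
        ; n≤0⇒n≡0; m≤n⇒m<n∨m≡n; suc-injective; 0≢1+n; +-suc; +-comm; +-assoc; +-identityʳ
        ; +-cancelˡ-≡; +-monoʳ-≤; +-mono-≤; +-monoʳ-<; m+n≡0⇒m≡0; m+n≡0⇒n≡0; m+[n∸m]≡n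
        ; m<n⇒0<n∸m; m∸n≤m; anyUpTo? )
open import Data.Product using (∃; _×_; _,_; proj₁; proj₂)
open import Data.Sum using (_⊎_; inj₁; inj₂)
open import Data.Vec using ([]; _∷_; tabulate)
import Data.Vec as Vec
open import Data.Vec.Base using (here; there)
open import Data.Vec.Properties using (lookup∘tabulate; lookup⇒[]=; []=⇒lookup)
open import Function using (_∘_; _$_)
open import Function.Bundles using (Equivalence)
open import Function.Definitions using (Injective)
open import Relation.Binary.Definitions using (tri<; tri≈; tri>)
open import Relation.Binary.PropositionalEquality
open import Relation.Nullary using (¬_; Dec; yes; no)
open import Relation.Nullary.Decidable using (⌊_⌋; toWitness; fromWitness; decidable-stable; _×-dec_; _⊎-dec_)
open import Relation.Unary using (Decidable)

-- Counting elements of finite subsets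

module _ {a : ℕ} where

  subsetOf : {P : Fin a → Set} → Decidable P → Subset a
  subsetOf P? = tabulate (⌊_⌋ ∘ P?)

  module _ {P : Fin a → Set} (P? : Decidable P) {x : Fin a} where

    ∈-subsetOf⁺ : P x → x ∈ subsetOf P?
    ∈-subsetOf⁺ px = lookup⇒[]= x _ (trans (lookup∘tabulate _ x) (Equivalence.to T-≡ (fromWitness px)))

    ∈-subsetOf⁻ : x ∈ subsetOf P? → P x
    ∈-subsetOf⁻ x∈ = toWitness (Equivalence.from T-≡ (trans (sym (lookup∘tabulate _ x)) ([]=⇒lookup x∈)))

indicator : Bool → ℕ
indicator b = if b then 1 else 0

indicator≡0⇒¬ : ∀ {A : Set} (A? : Dec A) → indicator ⌊ A? ⌋ ≡ 0 → ¬ A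
indicator≡0⇒¬ (no ¬a) _ = ¬a

¬⇒indicator≡0 : ∀ {A : Set} (A? : Dec A) → ¬ A → indicator ⌊ A? ⌋ ≡ 0
¬⇒indicator≡0 (yes a) ¬a = ⊥-elim (¬a a)
¬⇒indicator≡0 (no _)  _  = refl

∣∷∣ : ∀ {a} x (p : Subset a) → ∣ x ∷ p ∣ ≡ indicator x + ∣ p ∣
∣∷∣ true  p = refl
∣∷∣ false p = refl

sum-indicator≡∣tabulate∣ : ∀ {a} (b : Fin a → Bool) →
  sum (map (indicator ∘ b) (allFin a)) ≡ ∣ tabulate b ∣
sum-indicator≡∣tabulate∣ {zero}  b = refl
sum-indicator≡∣tabulate∣ {suc a} b = begin
  indicator (b zero) + sum (map (indicator ∘ b) (List.tabulate suc))
    ≡⟨ cong (λ xs → indicator (b zero) + sum xs) shift ⟩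
  indicator (b zero) + sum (map (indicator ∘ b ∘ suc) (allFin a))
    ≡⟨ cong (indicator (b zero) +_) (sum-indicator≡∣tabulate∣ (b ∘ suc)) ⟩
  indicator (b zero) + ∣ tabulate (b ∘ suc) ∣
    ≡⟨ ∣∷∣ (b zero) (tabulate (b ∘ suc)) ⟨
  ∣ tabulate b ∣ ∎
  where
    open ≡-Reasoning
    shift : map (indicator ∘ b) (List.tabulate suc) ≡ map (indicator ∘ b ∘ suc) (allFin a)
    shift = trans (map-tabulate suc (indicator ∘ b)) (sym (map-tabulate (λ i → i) (indicator ∘ b ∘ suc)))

∣p∪q∣≤∣p∣+∣q∣ : ∀ {a} (p q : Subset a) → ∣ p ∪ q ∣ ≤ ∣ p ∣ + ∣ q ∣
∣p∪q∣≤∣p∣+∣q∣ []            []            = z≤n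
∣p∪q∣≤∣p∣+∣q∣ (inside  ∷ p) (inside  ∷ q) = s≤s (≤-trans (∣p∪q∣≤∣p∣+∣q∣ p q) (+-monoʳ-≤ ∣ p ∣ (n≤1+n ∣ q ∣)))
∣p∪q∣≤∣p∣+∣q∣ (inside  ∷ p) (outside ∷ q) = s≤s (∣p∪q∣≤∣p∣+∣q∣ p q)
∣p∪q∣≤∣p∣+∣q∣ (outside ∷ p) (inside  ∷ q) =
  subst (suc ∣ p ∪ q ∣ ≤_) (sym (+-suc (∣ p ∣) (∣ q ∣))) (s≤s (∣p∪q∣≤∣p∣+∣q∣ p q))
∣p∪q∣≤∣p∣+∣q∣ (outside ∷ p) (outside ∷ q) = ∣p∪q∣≤∣p∣+∣q∣ p q

module _ {b : ℕ} where

  image : ∀ {a} → Subset a → (Fin a → Fin b) → Subset b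
  image []            f = ⊥
  image (inside  ∷ p) f = ⁅ f zero ⁆ ∪ image p (f ∘ suc)
  image (outside ∷ p) f = image p (f ∘ suc)

  ∣image∣≤∣p∣ : ∀ {a} (p : Subset a) f → ∣ image p f ∣ ≤ ∣ p ∣
  ∣image∣≤∣p∣ []            f = ≤-reflexive (∣⊥∣≡0 b)
  ∣image∣≤∣p∣ (inside  ∷ p) f = begin
    ∣ ⁅ f zero ⁆ ∪ image p (f ∘ suc) ∣      ≤⟨ ∣p∪q∣≤∣p∣+∣q∣ ⁅ f zero ⁆ (image p (f ∘ suc)) ⟩
    ∣ ⁅ f zero ⁆ ∣ + ∣ image p (f ∘ suc) ∣  ≡⟨ cong (_+ ∣ image p (f ∘ suc) ∣) (∣⁅x⁆∣≡1 (f zero)) ⟩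
    suc ∣ image p (f ∘ suc) ∣              ≤⟨ s≤s (∣image∣≤∣p∣ p (f ∘ suc)) ⟩
    suc ∣ p ∣                              ∎
    where open ≤-Reasoning
  ∣image∣≤∣p∣ (outside ∷ p) f = ∣image∣≤∣p∣ p (f ∘ suc)

  ∈-image : ∀ {a} (p : Subset a) f {x} → x ∈ p → f x ∈ image p f
  ∈-image (inside  ∷ p) f here        = x∈p∪q⁺ (inj₁ (x∈⁅x⁆ (f zero)))
  ∈-image (inside  ∷ p) f (there x∈p) = x∈p∪q⁺ (inj₂ (∈-image p (f ∘ suc) x∈p))
  ∈-image (outside ∷ p) f (there x∈p) = ∈-image p (f ∘ suc) x∈p

  MapsInto : ∀ {a} → Subset a → (Fin a → Fin b) → Subset b → Set
  MapsInto p f q = ∀ {x} → x ∈ p → f x ∈ q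

  InjectiveOn : ∀ {a} → Subset a → (Fin a → Fin b) → Set
  InjectiveOn p f = ∀ {x y} → x ∈ p → y ∈ p → f x ≡ f y → x ≡ y

  ∣p∣≤∣q∣-injectiveOn : ∀ {a} (p : Subset a) {q f} → MapsInto p f q → InjectiveOn p f → ∣ p ∣ ≤ ∣ q ∣
  ∣p∣≤∣q∣-injectiveOn []            _    _   = z≤n
  ∣p∣≤∣q∣-injectiveOn (outside ∷ p) into inj =
    ∣p∣≤∣q∣-injectiveOn p (into ∘ there) λ x∈ y∈ → Finₚ.suc-injective ∘ inj (there x∈) (there y∈)
  ∣p∣≤∣q∣-injectiveOn (inside  ∷ p) {q} {f} into inj =
    ≤-trans (s≤s (∣p∣≤∣q∣-injectiveOn p into′ λ x∈ y∈ → Finₚ.suc-injective ∘ inj (there x∈) (there y∈)))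
            (x∈p⇒∣p-x∣<∣p∣ (into here))
    where
      into′ : MapsInto p (f ∘ suc) (q - f zero)
      into′ x∈ = x∈p∧x≢y⇒x∈p-y (into (there x∈)) $ Finₚ.0≢1+n ∘ inj here (there x∈) ∘ sym

  ∣p∣+∣p′∣≤∣q∣-injectiveOn : ∀ {a a′} (p : Subset a) (p′ : Subset a′) {q f f′} →
    MapsInto p f q → MapsInto p′ f′ q → InjectiveOn p f → InjectiveOn p′ f′ →
    (∀ {x y} → x ∈ p → y ∈ p′ → f x ≢ f′ y) → ∣ p ∣ + ∣ p′ ∣ ≤ ∣ q ∣
  ∣p∣+∣p′∣≤∣q∣-injectiveOn [] p′ _ into′ _ inj′ _ = ∣p∣≤∣q∣-injectiveOn p′ into′ inj′
  ∣p∣+∣p′∣≤∣q∣-injectiveOn (outside ∷ p) p′ into into′ inj inj′ apart =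
    ∣p∣+∣p′∣≤∣q∣-injectiveOn p p′ (into ∘ there) into′
      (λ x∈ y∈ → Finₚ.suc-injective ∘ inj (there x∈) (there y∈)) inj′ (apart ∘ there)
  ∣p∣+∣p′∣≤∣q∣-injectiveOn (inside ∷ p) p′ {q} {f} {f′} into into′ inj inj′ apart =
    ≤-trans (s≤s (∣p∣+∣p′∣≤∣q∣-injectiveOn p p′ intoRest intoRest′
                    (λ x∈ y∈ → Finₚ.suc-injective ∘ inj (there x∈) (there y∈)) inj′ (apart ∘ there)))
            (x∈p⇒∣p-x∣<∣p∣ (into here))
    where
      intoRest : MapsInto p (f ∘ suc) (q - f zero)
      intoRest x∈ = x∈p∧x≢y⇒x∈p-y (into (there x∈)) $ Finₚ.0≢1+n ∘ inj here (there x∈) ∘ sym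
      intoRest′ : MapsInto p′ f′ (q - f zero)
      intoRest′ y∈ = x∈p∧x≢y⇒x∈p-y (into′ y∈) (apart here y∈ ∘ sym)

subset-argmin : ∀ a (f : Subset a → ℕ) → ∃ λ S → ∀ S′ → f S ≤ f S′
subset-argmin zero    f = [] , λ { [] → ≤-refl }
subset-argmin (suc a) f with subset-argmin a (f ∘ (inside ∷_)) | subset-argmin a (f ∘ (outside ∷_))
... | S₁ , min₁ | S₂ , min₂ with ≤-total (f (inside ∷ S₁)) (f (outside ∷ S₂))
... | inj₁ ≤₂ = inside ∷ S₁ , λ { (inside ∷ S) → min₁ S ; (outside ∷ S) → ≤-trans ≤₂ (min₂ S) }
... | inj₂ ≤₁ = outside ∷ S₂ , λ { (inside ∷ S) → ≤-trans ≤₁ (min₁ S) ; (outside ∷ S) → min₂ S }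

-- Spanning subgraphs and degrees

module _ {A : Set} where

  keep-index : ∀ (xs : List A) S → Fin (length (keep xs S)) → Fin (length xs)
  keep-index (x ∷ xs) (inside  ∷ S) zero    = zero
  keep-index (x ∷ xs) (inside  ∷ S) (suc i) = suc (keep-index xs S i)
  keep-index (x ∷ xs) (outside ∷ S) i       = suc (keep-index xs S i)

  lookup-keep : ∀ (xs : List A) S i → lookup (keep xs S) i ≡ lookup xs (keep-index xs S i)
  lookup-keep (x ∷ xs) (inside  ∷ S) zero    = refl
  lookup-keep (x ∷ xs) (inside  ∷ S) (suc i) = lookup-keep xs S i
  lookup-keep (x ∷ xs) (outside ∷ S) i       = lookup-keep xs S i

  keep-index-injective : ∀ (xs : List A) S {i j} → keep-index xs S i ≡ keep-index xs S j → i ≡ j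
  keep-index-injective (x ∷ xs) (inside  ∷ S) {zero}  {zero}  _  = refl
  keep-index-injective (x ∷ xs) (inside  ∷ S) {suc i} {suc j} eq =
    cong suc (keep-index-injective xs S (Finₚ.suc-injective eq))
  keep-index-injective (x ∷ xs) (outside ∷ S) eq = keep-index-injective xs S (Finₚ.suc-injective eq)

  keep-index-∈ : ∀ (xs : List A) S i → keep-index xs S i ∈ S
  keep-index-∈ (x ∷ xs) (inside  ∷ S) zero    = here
  keep-index-∈ (x ∷ xs) (inside  ∷ S) (suc i) = there (keep-index-∈ xs S i)
  keep-index-∈ (x ∷ xs) (outside ∷ S) i       = there (keep-index-∈ xs S i)

  keep-index-surjective : ∀ (xs : List A) S {j} → j ∈ S → ∃ λ i → keep-index xs S i ≡ j
  keep-index-surjective (x ∷ xs) (inside  ∷ S) here = zero , refl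
  keep-index-surjective (x ∷ xs) (inside  ∷ S) (there j∈) =
    let i , eq = keep-index-surjective xs S j∈ in suc i , cong suc eq
  keep-index-surjective (x ∷ xs) (outside ∷ S) (there j∈) =
    let i , eq = keep-index-surjective xs S j∈ in i , cong suc eq

  length-keep : ∀ (xs : List A) S → length (keep xs S) ≡ ∣ S ∣
  length-keep []       []            = refl
  length-keep (x ∷ xs) (inside  ∷ S) = cong suc (length-keep xs S)
  length-keep (x ∷ xs) (outside ∷ S) = length-keep xs S

module _ {n : ℕ} where

  Incident : Fin n × Fin n → Fin n → Set
  Incident p v = proj₁ p ≡ v ⊎ proj₂ p ≡ v

  degree≡0⇒¬Incident : ∀ (F : Graph n) {v} → degree F v ≡ 0 → ∀ e → ¬ Incident (lookup F e) v
  degree≡0⇒¬Incident ((a , b) ∷ F) {v} d≡0 zero (inj₁ a≡v) =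
    indicator≡0⇒¬ (a ≟ v) (m+n≡0⇒m≡0 _ (m+n≡0⇒m≡0 _ d≡0)) a≡v
  degree≡0⇒¬Incident ((a , b) ∷ F) {v} d≡0 zero (inj₂ b≡v) =
    indicator≡0⇒¬ (b ≟ v) (m+n≡0⇒n≡0 (indicator ⌊ a ≟ v ⌋) (m+n≡0⇒m≡0 _ d≡0)) b≡v
  degree≡0⇒¬Incident ((a , b) ∷ F) d≡0 (suc e) = degree≡0⇒¬Incident F (m+n≡0⇒n≡0 _ d≡0) e

  ¬Incident⇒degree≡0 : ∀ (F : Graph n) {v} → (∀ e → ¬ Incident (lookup F e) v) → degree F v ≡ 0
  ¬Incident⇒degree≡0 []            _      = refl
  ¬Incident⇒degree≡0 ((a , b) ∷ F) {v} ¬inc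
    rewrite ¬⇒indicator≡0 (a ≟ v) (¬inc zero ∘ inj₁) | ¬⇒indicator≡0 (b ≟ v) (¬inc zero ∘ inj₂) =
    ¬Incident⇒degree≡0 F (¬inc ∘ suc)

module _ {m : ℕ} (H : Graph m) where

  spanSub-cycle : ∀ T → Cycle (spanSub H T) → Cycle H
  spanSub-cycle T C = record
    { len₋₁ = len₋₁ C ; vert = vert C ; edge = keep-index H T ∘ edge C ; vert-inj = vert-inj C
    ; edge-inj = edge-inj C ∘ keep-index-injective H T
    ; joins = λ i → lift (joins C i) }
    where
      lift : ∀ {e a b} → Joins (keep H T) e a b → Joins H (keep-index H T e) a b
      lift {e} (inj₁ p) = inj₁ (trans (sym (lookup-keep H T e)) p)
      lift {e} (inj₂ p) = inj₂ (trans (sym (lookup-keep H T e)) p)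

  acyclic⇒spanningForest : Acyclic H → ∀ T → SpanningForest H T
  acyclic⇒spanningForest acyclic T = acyclic ∘ spanSub-cycle T

-- The cyclic successor

module _ {k : ℕ} where

  toℕ-mod : ∀ t → toℕ (t mod suc k) ≡ t % suc k
  toℕ-mod t = toℕ-fromℕ< _

  mod-toℕ : ∀ (i : Fin (suc k)) → toℕ i mod suc k ≡ i
  mod-toℕ i = toℕ-injective (trans (toℕ-mod (toℕ i)) (m<n⇒m%n≡m (toℕ<n i)))

  mod-cong : ∀ s t → s % suc k ≡ t % suc k → s mod suc k ≡ t mod suc k
  mod-cong s t eq = toℕ-injective (trans (toℕ-mod s) (trans eq (sym (toℕ-mod t))))

  mod-cong⁻ : ∀ s t → s mod suc k ≡ t mod suc k → s % suc k ≡ t % suc k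
  mod-cong⁻ s t eq = trans (sym (toℕ-mod s)) (trans (cong toℕ eq) (toℕ-mod t))

  mod-periodic : ∀ t → (suc k + t) mod suc k ≡ t mod suc k
  mod-periodic t = mod-cong (suc k + t) t (trans (cong (_% suc k) (+-comm (suc k) t)) ([m+n]%n≡m%n t (suc k)))

  suc-%-% : ∀ t → suc (t % suc k) % suc k ≡ suc t % suc k
  suc-%-% t = begin
    (1 + t % suc k) % suc k                 ≡⟨ %-distribˡ-+ 1 (t % suc k) (suc k) ⟩
    (1 % suc k + t % suc k % suc k) % suc k ≡⟨ cong (λ r → (1 % suc k + r) % suc k) (m%n%n≡m%n t (suc k)) ⟩
    (1 % suc k + t % suc k) % suc k         ≡⟨ %-distribˡ-+ 1 t (suc k) ⟨
    (1 + t) % suc k                         ∎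
    where open ≡-Reasoning

  m≡n⇒m%n≡0 : ∀ {r} → r ≡ suc k → r % suc k ≡ 0
  m≡n⇒m%n≡0 r≡ = trans (cong (_% suc k) r≡) (n%n≡0 (suc k))

  suc-%-injective : ∀ {s t} → s < suc k → t < suc k → suc s % suc k ≡ suc t % suc k → s ≡ t
  suc-%-injective {s} {t} s< t< eq with m≤n⇒m<n∨m≡n s< | m≤n⇒m<n∨m≡n t<
  ... | inj₁ s<k | inj₁ t<k = suc-injective (trans (sym (m<n⇒m%n≡m s<k)) (trans eq (m<n⇒m%n≡m t<k)))
  ... | inj₁ s<k | inj₂ t≡k = ⊥-elim (0≢1+n (trans (sym (m≡n⇒m%n≡0 t≡k)) (trans (sym eq) (m<n⇒m%n≡m s<k))))
  ... | inj₂ s≡k | inj₁ t<k = ⊥-elim (0≢1+n (trans (sym (m≡n⇒m%n≡0 s≡k)) (trans eq (m<n⇒m%n≡m t<k))))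
  ... | inj₂ s≡k | inj₂ t≡k = suc-injective (trans s≡k (sym t≡k))

module _ {n : ℕ} (G : Graph n) {k : ℕ} where

  next-mod : ∀ t → next G (t mod suc k) ≡ suc t mod suc k
  next-mod t =
    mod-cong (suc (toℕ (t mod suc k))) (suc t) (trans (cong (λ r → suc r % suc k) (toℕ-mod t)) (suc-%-% {k} t))

  next-injective : ∀ {i j : Fin (suc k)} → next G i ≡ next G j → i ≡ j
  next-injective {i} {j} eq =
    toℕ-injective (suc-%-injective (toℕ<n i) (toℕ<n j) (mod-cong⁻ (suc (toℕ i)) (suc (toℕ j)) eq))

  next-induction : ∀ (P : Fin (suc k) → Set) {i} → P i → (∀ {j} → P j → P (next G j)) → ∀ j → P j
  next-induction P {i} Pi P-next j = subst P reach (iterate (suc k ∸ toℕ i + toℕ j))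
    where
      iterate : ∀ s → P ((toℕ i + s) mod suc k)
      iterate zero    = subst P (sym (trans (cong (_mod suc k) (+-identityʳ (toℕ i))) (mod-toℕ i))) Pi
      iterate (suc s) = subst P (trans (next-mod (toℕ i + s)) (cong (_mod suc k) (sym (+-suc (toℕ i) s))))
                          (P-next (iterate s))
      reach : (toℕ i + (suc k ∸ toℕ i + toℕ j)) mod suc k ≡ j
      reach = begin
        (toℕ i + (suc k ∸ toℕ i + toℕ j)) mod suc k ≡⟨ cong (_mod suc k) (+-assoc (toℕ i) _ (toℕ j)) ⟨
        (toℕ i + (suc k ∸ toℕ i) + toℕ j) mod suc k ≡⟨ cong (λ r → (r + toℕ j) mod suc k) (m+[n∸m]≡n (<⇒≤ (toℕ<n i))) ⟩
        (suc k + toℕ j) mod suc k                   ≡⟨ mod-periodic (toℕ j) ⟩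
        toℕ j mod suc k                             ≡⟨ mod-toℕ j ⟩
        j                                           ∎
        where open ≡-Reasoning

  next-surjective : ∀ (j : Fin (suc k)) → ∃ λ i → next G i ≡ j
  next-surjective =
    next-induction (λ j → ∃ λ i → next G i ≡ j) (zero , refl) λ (i , eq) → next G i , cong (next G) eq

-- Closed trails contain cycles

skip : ℕ → ℕ → ℕ
skip i t with t <? i
... | yes _ = t
... | no  _ = suc t

skip-< : ∀ {i t} → t < i → skip i t ≡ t
skip-< {i} {t} t<i with t <? i
... | yes _   = refl
... | no  t≮i = ⊥-elim (t≮i t<i)

skip-≮ : ∀ {i t} → ¬ t < i → skip i t ≡ suc t
skip-≮ {i} {t} t≮i with t <? i
... | yes t<i = ⊥-elim (t≮i t<i)
... | no  _   = refl

skip-suc : ∀ i t → skip (suc i) (suc t) ≡ suc (skip i t)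
skip-suc i t with t <? i
... | yes t<i = skip-< (s≤s t<i)
... | no  t≮i = skip-≮ (t≮i ∘ s≤s⁻¹)

skip-≤ : ∀ i t → skip i t ≤ suc t
skip-≤ i t with t <? i
... | yes _ = n≤1+n t
... | no  _ = ≤-refl

skip-injective : ∀ i {s t} → skip i s ≡ skip i t → s ≡ t
skip-injective i {s} {t} eq with s <? i | t <? i
... | yes _   | yes _   = eq
... | yes s<i | no  t≮i = ⊥-elim (t≮i (<-trans (n<1+n t) (subst (_< i) eq s<i)))
... | no  s≮i | yes t<i = ⊥-elim (s≮i (<-trans (n<1+n s) (subst (_< i) (sym eq) t<i)))
... | no  _   | no  _   = suc-injective eq

skip-surjective : ∀ {i L s} → i ≤ L → s ≤ L → s ≢ i → ∃ λ t → t < L × skip i t ≡ s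
skip-surjective {i} {L} {s} i≤L s≤L s≢i with s <? i
... | yes s<i = s , <-≤-trans s<i i≤L , skip-< s<i
skip-surjective {i} {L} {zero}  i≤L s≤L s≢i | no s≮i = ⊥-elim (s≢i (sym (n≤0⇒n≡0 (≮⇒≥ s≮i))))
skip-surjective {i} {L} {suc s} i≤L s≤L s≢i | no s≮i with s <? i
... | yes s<i = ⊥-elim (s≢i (≤-antisym s<i (≮⇒≥ s≮i)))
... | no  s≮i = s , s≤L , skip-≮ s≮i

skip-pause : ∀ {A : Set} (f : ℕ → A) {i} → f i ≡ f (suc i) → ∀ t → f (skip (suc i) t) ≡ f (skip i t)
skip-pause f {i} pause t with <-cmp t i
... | tri< t<i _ _ = cong f (trans (skip-< (m<n⇒m<1+n t<i)) (sym (skip-< t<i)))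
... | tri≈ _ refl _ = trans (cong f (skip-< (n<1+n t))) (trans pause (cong f (sym (skip-≮ (<-irrefl refl)))))
... | tri> _ _ i<t = cong f (trans (skip-≮ (≤⇒≯ i<t)) (sym (skip-≮ (<-asym i<t))))

nothing? : ∀ {A : Set} (m : Maybe A) → Dec (m ≡ nothing)
nothing? nothing  = yes refl
nothing? (just _) = no λ ()

≢nothing⇒just : ∀ {A : Set} (m : Maybe A) → m ≢ nothing → ∃ λ a → m ≡ just a
≢nothing⇒just nothing  m≢ = ⊥-elim (m≢ refl)
≢nothing⇒just (just a) _  = a , refl

module _ {N : ℕ} (H : Graph N) where

  -- Pauses (`nothing`) let the sequence of owners along a cycle of G be read as a trail in CI.
  record ClosedTrail (L : ℕ) : Set where
    field
      at             : ℕ → Fin N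
      move           : ℕ → Maybe (Edge H)
      move-joins     : ∀ {t e} → t < L → move t ≡ just e → Joins H e (at t) (at (suc t))
      move-pauses    : ∀ {t} → t < L → move t ≡ nothing → at t ≡ at (suc t)
      closed         : at L ≡ at 0
      move-injective : ∀ {s t e} → s < L → t < L → move s ≡ just e → move t ≡ just e → s ≡ t
      nonempty       : ∃ λ t → t < L × ∃ λ e → move t ≡ just e

  open ClosedTrail

  dropPause : ∀ {L} (w : ClosedTrail (suc L)) {i} → i < suc L → move w i ≡ nothing → ClosedTrail L
  dropPause {L} w {i} i<1+L paused = record
    { at             = at w ∘ skip (suc i)
    ; move           = move w ∘ skip i
    ; move-joins     = λ {t} t<L eq → subst₂ (Joins H _) (sym (same t)) (cong (at w) (sym (skip-suc i t)))
                                         (move-joins w (bound t<L) eq)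
    ; move-pauses    = λ {t} t<L eq → trans (same t) (trans (move-pauses w (bound t<L) eq)
                                         (cong (at w) (sym (skip-suc i t))))
    ; closed         = trans (same L) (trans (cong (at w) (skip-≮ (≤⇒≯ (s≤s⁻¹ i<1+L)))) (closed w))
    ; move-injective = λ s<L t<L eq eq′ → skip-injective i (move-injective w (bound s<L) (bound t<L) eq eq′)
    ; nonempty       = survivor (nonempty w)
    }
    where
      same : ∀ t → at w (skip (suc i) t) ≡ at w (skip i t)
      same = skip-pause (at w) (move-pauses w i<1+L paused)
      bound : ∀ {t} → t < L → skip i t < suc L
      bound {t} t<L = s≤s (≤-trans (skip-≤ i t) t<L)
      survivor : (∃ λ s → s < suc L × ∃ λ e → move w s ≡ just e) → ∃ λ t → t < L × ∃ λ e → move w (skip i t) ≡ just e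
      survivor (s , s< , e , eq) =
        let t , t<L , skip≡ = skip-surjective (s≤s⁻¹ i<1+L) (s≤s⁻¹ s<) λ { refl → case (trans (sym eq) paused) }
        in t , t<L , e , trans (cong (move w) skip≡) eq
        where
          case : just e ≢ nothing
          case ()

  subTrail : ∀ {L} (w : ClosedTrail L) {a b} → a < b → b ≤ L → at w a ≡ at w b →
             (∃ λ e → move w a ≡ just e) → ClosedTrail (b ∸ a)
  subTrail {L} w {a} {b} a<b b≤L at≡ (e , eq) = record
    { at             = at w ∘ (a +_)
    ; move           = move w ∘ (a +_)
    ; move-joins     = λ {t} t< eq′ → subst (Joins H _ _) (cong (at w) (sym (+-suc a t)))
                                         (move-joins w (bound t<) eq′)
    ; move-pauses    = λ {t} t< eq′ → trans (move-pauses w (bound t<) eq′) (cong (at w) (sym (+-suc a t)))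
    ; closed         = trans (cong (at w) (m+[n∸m]≡n (<⇒≤ a<b)))
                             (trans (sym at≡) (cong (at w) (sym (+-identityʳ a))))
    ; move-injective = λ s< t< eq₁ eq₂ → +-cancelˡ-≡ a _ _ (move-injective w (bound s<) (bound t<) eq₁ eq₂)
    ; nonempty       = 0 , m<n⇒0<n∸m a<b , e , trans (cong (move w) (+-identityʳ a)) eq
    }
    where
      bound : ∀ {t} → t < b ∸ a → a + t < L
      bound {t} t< = <-≤-trans (subst (a + t <_) (m+[n∸m]≡n (<⇒≤ a<b)) (+-monoʳ-< a t<)) b≤L

  simpleTrail⇒cycle : ∀ {k} (w : ClosedTrail (suc k)) → (∀ {t} → t < suc k → ∃ λ e → move w t ≡ just e) →
            (∀ {s t} → s < suc k → t < suc k → at w s ≡ at w t → s ≡ t) → Cycle H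
  simpleTrail⇒cycle {k} w edgeAt at-injective = record
    { len₋₁    = k
    ; vert     = at w ∘ toℕ
    ; edge     = λ i → proj₁ (edgeAt (toℕ<n i))
    ; vert-inj = λ eq → toℕ-injective (at-injective (toℕ<n _) (toℕ<n _) eq)
    ; edge-inj = λ {i} {j} eq → toℕ-injective (move-injective w (toℕ<n i) (toℕ<n j)
                   (proj₂ (edgeAt (toℕ<n i))) (trans (proj₂ (edgeAt (toℕ<n j))) (cong just (sym eq))))
    ; joins    = λ i → subst (Joins H _ _) (sym (at-next i)) (move-joins w (toℕ<n i) (proj₂ (edgeAt (toℕ<n i))))
    }
    where
      at-next : ∀ i → at w (toℕ (next H i)) ≡ at w (suc (toℕ i))
      at-next i with m≤n⇒m<n∨m≡n (toℕ<n i)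
      ... | inj₁ 1+i<1+k = cong (at w) (trans (toℕ-mod (suc (toℕ i))) (m<n⇒m%n≡m 1+i<1+k))
      ... | inj₂ 1+i≡1+k = trans (cong (at w) (trans (toℕ-mod (suc (toℕ i))) (m≡n⇒m%n≡0 1+i≡1+k)))
                              (trans (sym (closed w)) (cong (at w) (sym 1+i≡1+k)))

  shortcutOrCycle : ∀ {k} (w : ClosedTrail (suc k)) → (∀ {t} → t < suc k → ∃ λ e → move w t ≡ just e) →
                    (∃ λ L → L < suc k × ClosedTrail L) ⊎ Cycle H
  shortcutOrCycle {k} w edgeAt with anyUpTo? (λ b → anyUpTo? (λ a → at w a ≟ at w b) b) (suc k)
  ... | yes (b , b< , a , a<b , at≡) =
          inj₁ (_ , ≤-<-trans (m∸n≤m b a) b< , subTrail w a<b (<⇒≤ b<) at≡ (edgeAt (<-trans a<b b<)))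
  ... | no noRepeat = inj₂ (simpleTrail⇒cycle w edgeAt at-injective)
    where
      at-injective : ∀ {s t} → s < suc k → t < suc k → at w s ≡ at w t → s ≡ t
      at-injective {s} {t} s< t< eq with <-cmp s t
      ... | tri< s<t _ _ = ⊥-elim (noRepeat (t , t< , s , s<t , eq))
      ... | tri≈ _ s≡t _ = s≡t
      ... | tri> _ _ t<s = ⊥-elim (noRepeat (s , s< , t , t<s , sym eq))

  trail⇒cycle : ∀ {L} → ClosedTrail L → Cycle H
  trail⇒cycle {L} = <-rec (λ L → ClosedTrail L → Cycle H) shorten L
    where
      shorten : ∀ L → (∀ {L′} → L′ < L → ClosedTrail L′ → Cycle H) → ClosedTrail L → Cycle H
      shorten zero    _   w = ⊥-elim (n≮0 (proj₁ (proj₂ (nonempty w))))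
      shorten (suc k) rec w with anyUpTo? (nothing? ∘ move w) (suc k)
      ... | yes (i , i< , paused) = rec ≤-refl (dropPause w i< paused)
      ... | no noPause with shortcutOrCycle w (λ t< → ≢nothing⇒just _ λ paused → noPause (_ , t< , paused))
      ...   | inj₁ (_ , L< , w′) = rec L< w′
      ...   | inj₂ C             = C

-- Short cycles and cycles inside cycles

module _ {A : Set} {x y : A} where

  lookup₂-injective : x ≢ y → Injective _≡_ _≡_ (Vec.lookup (x ∷ y ∷ []))
  lookup₂-injective x≢y {zero}     {zero}     _  = refl
  lookup₂-injective x≢y {zero}     {suc zero} eq = ⊥-elim (x≢y eq)
  lookup₂-injective x≢y {suc zero} {zero}     eq = ⊥-elim (x≢y (sym eq))
  lookup₂-injective x≢y {suc zero} {suc zero} _  = refl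

module _ {A : Set} {x y z : A} where

  lookup₃-injective : x ≢ y → y ≢ z → z ≢ x → Injective _≡_ _≡_ (Vec.lookup (x ∷ y ∷ z ∷ []))
  lookup₃-injective _   _   _   {zero}           {zero}           _  = refl
  lookup₃-injective x≢y _   _   {zero}           {suc zero}       eq = ⊥-elim (x≢y eq)
  lookup₃-injective _   _   z≢x {zero}           {suc (suc zero)} eq = ⊥-elim (z≢x (sym eq))
  lookup₃-injective x≢y _   _   {suc zero}       {zero}           eq = ⊥-elim (x≢y (sym eq))
  lookup₃-injective _   _   _   {suc zero}       {suc zero}       _  = refl
  lookup₃-injective _   y≢z _   {suc zero}       {suc (suc zero)} eq = ⊥-elim (y≢z eq)
  lookup₃-injective _   _   z≢x {suc (suc zero)} {zero}           eq = ⊥-elim (z≢x eq)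
  lookup₃-injective _   y≢z _   {suc (suc zero)} {suc zero}       eq = ⊥-elim (y≢z (sym eq))
  lookup₃-injective _   _   _   {suc (suc zero)} {suc (suc zero)} _  = refl

module _ {N : ℕ} (H : Graph N) where

  Joins-sym : ∀ {e a b} → Joins H e a b → Joins H e b a
  Joins-sym (inj₁ p) = inj₂ p
  Joins-sym (inj₂ p) = inj₁ p

  Joins⇒Incident : ∀ {e a b} → Joins H e a b → Incident (ends H e) a
  Joins⇒Incident (inj₁ p) = inj₁ (cong proj₁ p)
  Joins⇒Incident (inj₂ p) = inj₂ (cong proj₂ p)

  Joins-endpoint : ∀ {e a b c d} → Joins H e a b → Joins H e c d → c ≡ a ⊎ c ≡ b
  Joins-endpoint (inj₁ p) (inj₁ q) = inj₁ (cong proj₁ (trans (sym q) p))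
  Joins-endpoint (inj₁ p) (inj₂ q) = inj₂ (cong proj₂ (trans (sym q) p))
  Joins-endpoint (inj₂ p) (inj₁ q) = inj₂ (cong proj₁ (trans (sym q) p))
  Joins-endpoint (inj₂ p) (inj₂ q) = inj₁ (cong proj₂ (trans (sym q) p))

  Joins-apart : ∀ {e f a b x y} → Joins H e a b → Joins H f x y → x ≢ a → x ≢ b → e ≢ f
  Joins-apart je jf x≢a x≢b refl with Joins-endpoint je jf
  ... | inj₁ x≡a = x≢a x≡a
  ... | inj₂ x≡b = x≢b x≡b

  digon : ∀ {a b e f} → a ≢ b → e ≢ f → Joins H e a b → Joins H f b a → Cycle H
  digon {a} {b} {e} {f} a≢b e≢f je jf = record
    { len₋₁ = 1 ; vert = Vec.lookup (a ∷ b ∷ []) ; edge = Vec.lookup (e ∷ f ∷ [])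
    ; vert-inj = lookup₂-injective a≢b ; edge-inj = lookup₂-injective e≢f
    ; joins = λ { zero → je ; (suc zero) → jf }
    }

  triangle : ∀ {a b c e f g} → a ≢ b → b ≢ c → c ≢ a →
             Joins H e a b → Joins H f b c → Joins H g c a → Cycle H
  triangle {a} {b} {c} {e} {f} {g} a≢b b≢c c≢a je jf jg = record
    { len₋₁ = 2 ; vert = Vec.lookup (a ∷ b ∷ c ∷ []) ; edge = Vec.lookup (e ∷ f ∷ g ∷ [])
    ; vert-inj = lookup₃-injective a≢b b≢c c≢a
    ; edge-inj = lookup₃-injective (Joins-apart je (Joins-sym jf) c≢a (b≢c ∘ sym))
                                   (Joins-apart jf (Joins-sym jg) a≢b (c≢a ∘ sym))
                                   (Joins-apart jg (Joins-sym je) b≢c (a≢b ∘ sym))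
    ; joins = λ { zero → je ; (suc zero) → jf ; (suc (suc zero)) → jg }
    }

  acyclic-clique-edge-unique : Acyclic H → (O : Fin N → Set) →
    (∀ {x y} → x ≢ y → O x → O y → ∃ λ f → Joins H f x y) →
    ∀ {e e′ a b c d} → a ≢ b → c ≢ d → Joins H e a b → Joins H e′ c d → O a → O b → O c → O d → e ≡ e′
  acyclic-clique-edge-unique acyclic O adjacent {e} {e′} {a} {b} {c} {d} a≢b c≢d je je′ Oa Ob Oc Od
    with e ≟ e′
  ... | yes e≡e′ = e≡e′
  ... | no  e≢e′ = ⊥-elim (acyclic cycle)
    where
      closeTriangle : ∀ {x} → O x → x ≢ a → x ≢ b → Cycle H
      closeTriangle Ox x≢a x≢b =
        triangle a≢b (x≢b ∘ sym) x≢a je (proj₂ (adjacent (x≢b ∘ sym) Ob Ox)) (proj₂ (adjacent x≢a Ox Oa))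
      cycle : Cycle H
      cycle with c ≟ a | c ≟ b
      ... | no c≢a | no c≢b = closeTriangle Oc c≢a c≢b
      ... | yes refl | _ with d ≟ b
      ...   | yes refl = digon a≢b e≢e′ je (Joins-sym je′)
      ...   | no d≢b   = closeTriangle Od (c≢d ∘ sym) d≢b
      cycle | no _ | yes refl with d ≟ a
      ...   | yes refl = digon a≢b e≢e′ je je′
      ...   | no d≢a   = closeTriangle Od d≢a (c≢d ∘ sym)

module _ {n : ℕ} (G : Graph n) where

  EdgeOf : Edge G → Cycle G → Set
  EdgeOf e C = ∃ λ i → edge C i ≡ e

  edge-ends-on-cycle : (C : Cycle G) → ∀ {e a b} → EdgeOf e C → Joins G e a b → OnCycle G a C × OnCycle G b C
  edge-ends-on-cycle C (i , refl) jab =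
    on (Joins-endpoint G (joins C i) jab) , on (Joins-endpoint G (joins C i) (Joins-sym G jab))
    where
      on : ∀ {x} → x ≡ vert C i ⊎ x ≡ vert C (next G i) → OnCycle G x C
      on (inj₁ x≡) = i , sym x≡
      on (inj₂ x≡) = next G i , sym x≡

  next≢ : Loopless G → (C : Cycle G) → ∀ i → next G i ≢ i
  next≢ loopless C i next≡ =
    loopless (edge C i) (self-loop (subst (Joins G (edge C i) (vert C i) ∘ vert C) next≡ (joins C i)))
    where
      self-loop : ∀ {e v} → Joins G e v v → proj₁ (ends G e) ≡ proj₂ (ends G e)
      self-loop (inj₁ p) = trans (cong proj₁ p) (sym (cong proj₂ p))
      self-loop (inj₂ p) = trans (cong proj₁ p) (sym (cong proj₂ p))

  second-edge : Loopless G → (C : Cycle G) → ∀ {i v} → v ≡ vert C i ⊎ v ≡ vert C (next G i) →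
                ∃ λ i′ → i′ ≢ i × ∃ λ w → Joins G (edge C i′) v w
  second-edge loopless C {i} (inj₂ refl) = next G i , next≢ loopless C i , _ , joins C (next G i)
  second-edge loopless C {i} (inj₁ refl) with next-surjective G i
  ... | i′ , refl = i′ , next≢ loopless C i′ ∘ sym , _ , Joins-sym G (joins C i′)

  module _ (loopless : Loopless G) (C C′ : Cycle G) (C⊆C′ : ∀ i → EdgeOf (edge C i) C′) where

    edgeOf-next : ∀ {p} → EdgeOf (edge C′ p) C → EdgeOf (edge C′ (next G p)) C
    edgeOf-next {p} (i , edge≡)
      with second-edge loopless C
             (Joins-endpoint G (joins C i) (subst (λ e → Joins G e _ _) (sym edge≡) (Joins-sym G (joins C′ p))))
    ... | i′ , i′≢i , _ , joins-i′ with C⊆C′ i′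
    ...   | q , edge-q≡ with Joins-endpoint G (subst (λ e → Joins G e _ _) edge-q≡ (joins C′ q)) joins-i′
    ...     | inj₁ at-q      = i′ , trans (sym edge-q≡) (cong (edge C′) (sym (vert-inj C′ at-q)))
    ...     | inj₂ at-next-q = ⊥-elim (i′≢i (edge-inj C (trans edge-q≡′ (sym edge≡))))
      where
        edge-q≡′ : edge C i′ ≡ edge C′ p
        edge-q≡′ = trans (sym edge-q≡) (cong (edge C′) (next-injective G (sym (vert-inj C′ at-next-q))))

    edges-⊇ : ∀ q → EdgeOf (edge C′ q) C
    edges-⊇ = next-induction G (λ q → EdgeOf (edge C′ q) C) (zero , sym (proj₂ (C⊆C′ zero))) edgeOf-next

    vertices-⊇ : ∀ q → OnCycle G (vert C′ q) C
    vertices-⊇ q = proj₁ (edge-ends-on-cycle C (edges-⊇ q) (joins C′ q))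

-- The cycle intersection graph

module _ {A B : Set} (f : A → B) where

  lookup-map : ∀ xs i → lookup (map f xs) i ≡ f (lookup xs (cast (length-map f xs) i))
  lookup-map (x ∷ xs) zero    = refl
  lookup-map (x ∷ xs) (suc i) = lookup-map xs i

  record Relabelling (ys : List B) (xs : List A) : Set where
    field
      index         : Fin (length ys) → Fin (length xs)
      unindex       : Fin (length xs) → Fin (length ys)
      lookup-index  : ∀ i → lookup ys i ≡ f (lookup xs (index i))
      index-unindex : ∀ i → index (unindex i) ≡ i

  relabelling : ∀ {ys xs} → ys ≡ map f xs → Relabelling ys xs
  relabelling {xs = xs} refl = record
    { index         = cast (length-map f xs)
    ; unindex       = cast (sym (length-map f xs))
    ; lookup-index  = lookup-map xs
    ; index-unindex = cast-involutive (length-map f xs) (sym (length-map f xs))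
    }

module _ {n : ℕ} (G : Graph n) (D : CycleDecomp G) where

  private
    m : ℕ
    m = count D

  _∈ᴰ_ : Fin n → Fin m → Set
  v ∈ᴰ j = OnCycle G v (cyc D j)

  Labelled : Set
  Labelled = (Fin m × Fin m) × Fin n

  CIEntry : Labelled → Set
  CIEntry ((j , j′) , v) = toℕ j < toℕ j′ × v ∈ᴰ j × v ∈ᴰ j′

  CIEntry? : ∀ j j′ v → Dec (CIEntry ((j , j′) , v))
  CIEntry? j j′ v = (toℕ j <? toℕ j′) ×-dec (onCycle? G v (cyc D j) ×-dec onCycle? G v (cyc D j′))

  labelledCI : List Labelled
  labelledCI =
    concatMap (λ j → concatMap (λ j′ → concatMap (λ v →
      if ⌊ CIEntry? j j′ v ⌋ then ((j , j′) , v) ∷ [] else [])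
      (allFin n)) (allFin m)) (allFin m)

  CI≡unlabelled : CI G D ≡ map proj₁ labelledCI
  CI≡unlabelled =
    sym (push (λ j → push (λ j′ → push (λ v → map-singleton (CIEntry? j j′ v)) (allFin n)) (allFin m)) (allFin m))
    where
      push : ∀ {X Y Z : Set} {f : Y → Z} {g : X → List Y} {h : X → List Z} →
             (∀ x → map f (g x) ≡ h x) → ∀ xs → map f (concatMap g xs) ≡ concatMap h xs
      push {f = f} {g} g≗h xs = trans (map-concatMap f g xs) (concatMap-cong g≗h xs)
      map-singleton : ∀ {P : Set} {x : Labelled} (P? : Dec P) →
                      map proj₁ (if ⌊ P? ⌋ then x ∷ [] else []) ≡ (if ⌊ P? ⌋ then proj₁ x ∷ [] else [])
      map-singleton (yes _) = refl
      map-singleton (no _)  = refl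

  ∈-labelledCI⁻ : ∀ {t} → t ∈ˡ labelledCI → CIEntry t
  ∈-labelledCI⁻ t∈ with satisfied (∈-concatMap⁻ _ {allFin m} t∈)
  ... | j , t∈ⱼ with satisfied (∈-concatMap⁻ _ {allFin m} t∈ⱼ)
  ... | j′ , t∈ⱼⱼ′ with satisfied (∈-concatMap⁻ _ {allFin n} t∈ⱼⱼ′)
  ... | v , t∈ⱼⱼ′ᵥ = selected (CIEntry? j j′ v) t∈ⱼⱼ′ᵥ
    where
      selected : ∀ {t x} (x? : Dec (CIEntry x)) → t ∈ˡ (if ⌊ x? ⌋ then x ∷ [] else []) → CIEntry t
      selected (yes x-entry) (here refl) = x-entry

  ∈-labelledCI⁺ : ∀ {j j′ v} → CIEntry ((j , j′) , v) → ((j , j′) , v) ∈ˡ labelledCI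
  ∈-labelledCI⁺ {j} {j′} {v} entry =
    ∈-concatMap⁺ _ (Any.map (λ { refl → ∈-concatMap⁺ _ (Any.map (λ { refl → ∈-concatMap⁺ _ (Any.map (λ { refl →
      selected (CIEntry? j j′ v) }) (∈-allFin v)) }) (∈-allFin j′)) }) (∈-allFin j))
    where
      selected : (x? : Dec (CIEntry ((j , j′) , v))) → ((j , j′) , v) ∈ˡ (if ⌊ x? ⌋ then ((j , j′) , v) ∷ [] else [])
      selected (yes _)         = here refl
      selected (no not-entry) = ⊥-elim (not-entry entry)

  open Relabelling (relabelling proj₁ CI≡unlabelled)

  label : Edge (CI G D) → Fin n
  label e = proj₂ (lookup labelledCI (index e))

  CI-entry : ∀ e → CIEntry (ends (CI G D) e , label e)
  CI-entry e = subst (λ p → CIEntry (p , label e)) (sym (lookup-index e)) (∈-labelledCI⁻ (∈-lookup (index e)))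

  CI-loopless : Loopless (CI G D)
  CI-loopless e eq = <-irrefl (cong toℕ eq) (proj₁ (CI-entry e))

  label-on-ends : ∀ e → label e ∈ᴰ proj₁ (ends (CI G D) e) × label e ∈ᴰ proj₂ (ends (CI G D) e)
  label-on-ends e = proj₂ (CI-entry e)

  CI-edge-of-entry : ∀ {a b v} → CIEntry ((a , b) , v) → ∃ λ e → ends (CI G D) e ≡ (a , b) × label e ≡ v
  CI-edge-of-entry {a} {b} {v} entry = unindex i , trans (lookup-index _) (cong proj₁ at-i) , cong proj₂ at-i
    where
      i∈ = ∈-labelledCI⁺ entry
      i = Any.index i∈
      at-i : lookup labelledCI (index (unindex i)) ≡ ((a , b) , v)
      at-i = trans (cong (lookup labelledCI) (index-unindex i)) (sym (Anyₚ.lookup-index i∈))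

  CI-edge : ∀ {j j′ v} → j ≢ j′ → v ∈ᴰ j → v ∈ᴰ j′ → ∃ λ e → Joins (CI G D) e j j′ × label e ≡ v
  CI-edge {j} {j′} {v} j≢j′ v∈j v∈j′ with <-cmp (toℕ j) (toℕ j′)
  ... | tri< j<j′ _ _ = let e , ends≡ , label≡ = CI-edge-of-entry (j<j′ , v∈j , v∈j′) in e , inj₁ ends≡ , label≡
  ... | tri≈ _ j≡j′ _ = ⊥-elim (j≢j′ (toℕ-injective j≡j′))
  ... | tri> _ _ j′<j = let e , ends≡ , label≡ = CI-edge-of-entry (j′<j , v∈j′ , v∈j) in e , inj₂ ends≡ , label≡

  owner : Edge G → Fin (count D)
  owner e = proj₁ (cover D e)

  edgeOf-owner : ∀ e → EdgeOf G e (cyc D (owner e))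
  edgeOf-owner e = proj₂ (cover D e)

  module Around (C : Cycle G) where

    k : ℕ
    k = len₋₁ C

    at : ℕ → Fin n
    at t = vert C (t mod suc k)

    along : ℕ → Edge G
    along t = edge C (t mod suc k)

    along-joins : ∀ t → Joins G (along t) (at t) (at (suc t))
    along-joins t = subst (Joins G (along t) (at t) ∘ vert C) (next-mod G t) (joins C (t mod suc k))

    ownerAt : ℕ → Fin (count D)
    ownerAt t = owner (along t)

    along-on-owner : ∀ t → at t ∈ᴰ ownerAt t × at (suc t) ∈ᴰ ownerAt t
    along-on-owner t = edge-ends-on-cycle G (cyc D (ownerAt t)) (edgeOf-owner (along t)) (along-joins t)

    at-on-owners : ∀ t → at (suc t) ∈ᴰ ownerAt t × at (suc t) ∈ᴰ ownerAt (suc t)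
    at-on-owners t = proj₂ (along-on-owner t) , proj₁ (along-on-owner (suc t))

    crossing : ∀ t → Dec (ownerAt t ≡ ownerAt (suc t)) → Maybe (Edge (CI G D))
    crossing t (yes _)  = nothing
    crossing t (no ≢ᵗ) = just (proj₁ (CI-edge ≢ᵗ (proj₁ (at-on-owners t)) (proj₂ (at-on-owners t))))

    crossing-joins : ∀ t d {e} → crossing t d ≡ just e →
                     Joins (CI G D) e (ownerAt t) (ownerAt (suc t)) × label e ≡ at (suc t)
    crossing-joins t (no ≢ᵗ) refl = proj₂ (CI-edge ≢ᵗ (proj₁ (at-on-owners t)) (proj₂ (at-on-owners t)))

    crossing-pauses : ∀ t d → crossing t d ≡ nothing → ownerAt t ≡ ownerAt (suc t)
    crossing-pauses t (yes ≡ᵗ) _ = ≡ᵗ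

    -- Distinct crossings are labelled by distinct vertices of C, hence use distinct edges of CI.
    ownerTrail : ∀ {t} → t < suc k → ownerAt t ≢ ownerAt (suc t) → ClosedTrail (CI G D) (suc k)
    ownerTrail {t₀} t₀< ≢₀ = record
      { at             = ownerAt
      ; move           = λ t → crossing t (ownerAt t ≟ ownerAt (suc t))
      ; move-joins     = λ {t} _ eq → proj₁ (crossing-joins t _ eq)
      ; move-pauses    = λ {t} _ eq → crossing-pauses t _ eq
      ; closed         = cong (owner ∘ edge C) (mod-cong (suc k) 0 (n%n≡0 (suc k)))
      ; move-injective = λ {s} {t} s< t< eq eq′ → suc-%-injective s< t<
                           (mod-cong⁻ (suc s) (suc t) (vert-inj C (trans (sym (proj₂ (crossing-joins s _ eq)))
                                                                         (proj₂ (crossing-joins t _ eq′)))))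
      ; nonempty       = t₀ , t₀< , crosses
      }
      where
        crosses : ∃ λ e → crossing t₀ (ownerAt t₀ ≟ ownerAt (suc t₀)) ≡ just e
        crosses with ownerAt t₀ ≟ ownerAt (suc t₀)
        ... | yes ≡ᵗ = ⊥-elim (≢₀ ≡ᵗ)
        ... | no _   = _ , refl

    owner-constant : Acyclic (CI G D) → ∀ {t} → t ≤ suc k → ownerAt t ≡ ownerAt 0
    owner-constant acyclic {zero}  _     = refl
    owner-constant acyclic {suc t} t<1+k with ownerAt t ≟ ownerAt (suc t)
    ... | yes ≡ᵗ = trans (sym ≡ᵗ) (owner-constant acyclic (<⇒≤ t<1+k))
    ... | no ≢ᵗ  = ⊥-elim (acyclic (trail⇒cycle (CI G D) (ownerTrail t<1+k ≢ᵗ)))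

  single-owner : Acyclic (CI G D) → (C : Cycle G) → ∀ i → owner (edge C i) ≡ owner (edge C zero)
  single-owner acyclic C i =
    trans (cong (owner ∘ edge C) (sym (mod-toℕ i))) (owner-constant acyclic (<⇒≤ (toℕ<n i)))
    where open Around C

  decompositionCycle-⊆ : Loopless G → Acyclic (CI G D) → (C : Cycle G) →
                          ∃ λ j → ∀ q → OnCycle G (vert (cyc D j) q) C
  decompositionCycle-⊆ loopless acyclic C = owner (edge C zero) , vertices-⊇ G loopless C (cyc D _) C⊆
    where
      C⊆ : ∀ i → EdgeOf G (edge C i) (cyc D (owner (edge C zero)))
      C⊆ i = subst (EdgeOf G (edge C i) ∘ cyc D) (single-owner acyclic C i) (edgeOf-owner (edge C i))

  -- Spanning forests of CI and decycling sets of G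

  module _ (acyclic : Acyclic (CI G D)) where

    private
      H = CI G D

    label-injective : ∀ {e e′} → label e ≡ label e′ → e ≡ e′
    label-injective {e} {e′} label≡ =
      acyclic-clique-edge-unique H acyclic (label e ∈ᴰ_) adjacent (CI-loopless e) (CI-loopless e′)
        (inj₁ refl) (inj₁ refl) (proj₁ (label-on-ends e)) (proj₂ (label-on-ends e))
        (moved (proj₁ (label-on-ends e′))) (moved (proj₂ (label-on-ends e′)))
      where
        adjacent : ∀ {x y} → x ≢ y → label e ∈ᴰ x → label e ∈ᴰ y → ∃ λ f → Joins H f x y
        adjacent x≢y x∋ y∋ = let f , joins , _ = CI-edge x≢y x∋ y∋ in f , joins
        moved : ∀ {x} → label e′ ∈ᴰ x → label e ∈ᴰ x
        moved {x} = subst (_∈ᴰ x) (sym label≡)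

    Isolated : Subset (length H) → Subset m
    Isolated T = subsetOf (λ j → degree (spanSub H T) j ℕ.≟ 0)

    forestSize≡ : ∀ T → forestSize H T ≡ ∣ T ∣ + ∣ Isolated T ∣
    forestSize≡ T = cong₂ _+_ (length-keep H T) (sum-indicator≡∣tabulate∣ {m} _)

    isolated⇒¬Incident : ∀ {T j e} → j ∈ Isolated T → e ∈ T → ¬ Incident (ends H e) j
    isolated⇒¬Incident {T} {j} {e} j∈ e∈ incident =
      let e′ , index≡ = keep-index-surjective H T e∈
      in degree≡0⇒¬Incident (spanSub H T) (∈-subsetOf⁻ _ j∈) e′
           (subst (λ p → Incident p j) (sym (trans (lookup-keep H T e′) (cong (lookup H) index≡))) incident)

    ¬Incident⇒isolated : ∀ {T j} → (∀ {e} → e ∈ T → ¬ Incident (ends H e) j) → j ∈ Isolated T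
    ¬Incident⇒isolated {T} {j} unused = ∈-subsetOf⁺ _ (¬Incident⇒degree≡0 (spanSub H T) λ e incident →
      unused (keep-index-∈ H T e) (subst (λ p → Incident p j) (lookup-keep H T e) incident))

    Incident⇒∈ᴰ : ∀ {e j} → Incident (ends H e) j → label e ∈ᴰ j
    Incident⇒∈ᴰ {e} (inj₁ refl) = proj₁ (label-on-ends e)
    Incident⇒∈ᴰ {e} (inj₂ refl) = proj₂ (label-on-ends e)

    forest-from-decycling : ∀ {S} → Decycling G S → ∃ λ T → forestSize H T ≤ ∣ S ∣
    forest-from-decycling {S} decycling =
      T , subst (_≤ ∣ S ∣) (sym (forestSize≡ T))
                (∣p∣+∣p′∣≤∣q∣-injectiveOn T (Isolated T) (∈-subsetOf⁻ labelled?) (λ {j} _ → chosen∈S j)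
                   (λ _ _ → label-injective) chosen-injective label≢chosen)
      where
        pick : ∀ j → ∃ λ i → vert (cyc D j) i ∈ S
        pick j with any? (λ i → vert (cyc D j) i ∈? S)
        ... | yes hit = hit
        ... | no miss = ⊥-elim (decycling (cyc D j , λ i v∈S → miss (i , v∈S)))
        chosen : Fin m → Fin n
        chosen j = vert (cyc D j) (proj₁ (pick j))
        chosen∈S : ∀ j → chosen j ∈ S
        chosen∈S j = proj₂ (pick j)
        chosen∈ᴰ : ∀ j → chosen j ∈ᴰ j
        chosen∈ᴰ j = proj₁ (pick j) , refl
        labelled? : Decidable (λ e → label e ∈ S)
        labelled? e = label e ∈? S
        T : Subset (length H)
        T = subsetOf labelled?
        only-owner : ∀ {j x} → j ∈ Isolated T → chosen j ∈ᴰ x → x ≡ j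
        only-owner {j} {x} j∈ on-x = decidable-stable (x ≟ j) λ x≢j →
          let e , joins , label≡ = CI-edge (x≢j ∘ sym) (chosen∈ᴰ j) on-x
          in isolated⇒¬Incident j∈ (∈-subsetOf⁺ labelled? (subst (_∈ S) (sym label≡) (chosen∈S j)))
                                   (Joins⇒Incident H joins)
        chosen-injective : InjectiveOn (Isolated T) chosen
        chosen-injective {j} {j′} j∈ j′∈ chosen≡ = sym (only-owner j∈ (subst (_∈ᴰ j′) (sym chosen≡) (chosen∈ᴰ j′)))
        label≢chosen : ∀ {e j} → e ∈ T → j ∈ Isolated T → label e ≢ chosen j
        label≢chosen {e} {j} _ j∈ label≡ =
          CI-loopless e (trans (only-owner j∈ (moved (proj₁ (label-on-ends e))))
                               (sym (only-owner j∈ (moved (proj₂ (label-on-ends e))))))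
          where
            moved : ∀ {x} → label e ∈ᴰ x → chosen j ∈ᴰ x
            moved {x} = subst (_∈ᴰ x) label≡

    decycling-from-forest : Loopless G → ∀ T → ∃ λ S → Decycling G S × ∣ S ∣ ≤ forestSize H T
    decycling-from-forest loopless T = S , decycling , size
      where
        first : Fin m → Fin n
        first j = vert (cyc D j) zero
        S : Subset n
        S = image T label ∪ image (Isolated T) first
        size : ∣ S ∣ ≤ forestSize H T
        size = subst (∣ S ∣ ≤_) (sym (forestSize≡ T))
          (≤-trans (∣p∪q∣≤∣p∣+∣q∣ (image T label) (image (Isolated T) first))
                   (+-mono-≤ (∣image∣≤∣p∣ T label) (∣image∣≤∣p∣ (Isolated T) first)))
        meets : ∀ j → ∃ λ i → vert (cyc D j) i ∈ S
        meets j = by-cases (j ∈? Isolated T)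
                           (any? λ e → (e ∈? T) ×-dec ((proj₁ (ends H e) ≟ j) ⊎-dec (proj₂ (ends H e) ≟ j)))
          where
            by-cases : Dec (j ∈ Isolated T) → Dec (∃ λ e → e ∈ T × Incident (ends H e) j) →
                       ∃ λ i → vert (cyc D j) i ∈ S
            by-cases (yes j∈) _ = zero , x∈p∪q⁺ (inj₂ (∈-image (Isolated T) first j∈))
            by-cases (no _) (yes (e , e∈ , incident)) =
              let i , at-i = Incident⇒∈ᴰ incident in i , subst (_∈ S) (sym at-i) (x∈p∪q⁺ (inj₁ (∈-image T label e∈)))
            by-cases (no j∉) (no unused) = ⊥-elim (j∉ (¬Incident⇒isolated λ e∈ incident → unused (_ , e∈ , incident)))
        decycling : Decycling G S
        decycling (C , avoids) =
          let j , ⊆C = decompositionCycle-⊆ loopless acyclic C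
              i , v∈S = meets j
              p , at-p = ⊆C i
          in avoids p (subst (_∈ S) (sym at-p) v∈S)

theorem2 : ∀ {n : ℕ} (G : Graph n) → Loopless G → Connected G → Even G →
    (D : CycleDecomp G) → IsTree (CI G D) →
    ∃ λ k → DecyclingNumber G k × MSFSize (CI G D) k
theorem2 G loopless _ _ D (_ , acyclic) with subset-argmin (length (CI G D)) (forestSize (CI G D))
... | T* , T*-minimal with decycling-from-forest G D acyclic loopless T*
...   | S , decycling , S≤T* =
  forestSize (CI G D) T* ,
  ((S , decycling , ≤-antisym S≤T* (≤-minimal S decycling)) , ≤-minimal) ,
  ((T* , acyclic⇒spanningForest (CI G D) acyclic T* , refl) , λ T _ → T*-minimal T)
  where
    ≤-minimal : ∀ S′ → Decycling G S′ → forestSize (CI G D) T* ≤ ∣ S′ ∣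
    ≤-minimal S′ decycling′ =
      let T , T≤S′ = forest-from-decycling G D acyclic decycling′ in ≤-trans (T*-minimal T) T≤S′
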